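{- $$\sum_{n=0}^{\infty}(G_n-G_{n-1})\,G_{n+1}=1+2C,$$ as formal power series in $x$.
   Context: Paths use steps $(1,1)$ and $(1,-1)$; a Dyck path of semilength $n$ starts at $(0,0)$, ends at $(2n,0)$ and never goes below level ($y$-coordinate) $0$; its height is the maximum level reached (the empty path has height $0$). Let $c(x)=\sum_{n\ge0}\frac{1}{n+1}\binom{2n}{n}x^n=\frac{1-\sqrt{1-4x}}{2x}$ and $C=c(x)-1=xc(x)^2$. For an integer $k$, $G_k=\sum_P x^{\text{semilength}(P)}$, the sum over all Dyck paths $P$ of height at most $k$ (so $G_{ -1}=0$). -}

module Defs where

open import Data.Nat using (ℕ; zero; suc; _+_; _*_; _∸_; _⊔_; _≤ᵇ_; _≡ᵇ_)
open import Data.Nat.Combinatorics using (_C_)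
open import Data.Nat.DivMod using (_/_)
open import Data.Bool using (Bool; true; false; _∧_)
open import Data.List using (List; []; _∷_; concatMap; filter; length)
open import Data.Integer as ℤ using (ℤ; +_)
open import Relation.Nullary.Decidable using (Dec; yes; no)
open import Data.Bool.Properties using (T?)
open import Data.Bool using (T)

data Step : Set where
  U D : Step   -- U = (1,1), D = (1,-1)

words : ℕ → List (List Step)
words zero    = [] ∷ []
words (suc n) = concatMap (λ w → (U ∷ w) ∷ (D ∷ w) ∷ []) (words n)

staysEnds0 : ℕ → List Step → Bool
staysEnds0 h       []      = h ≡ᵇ 0
staysEnds0 h       (U ∷ w) = staysEnds0 (suc h) w
staysEnds0 zero    (D ∷ w) = false
staysEnds0 (suc h) (D ∷ w) = staysEnds0 h w

isDyck : List Step → Bool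
isDyck w = staysEnds0 0 w

maxLevel : ℕ → List Step → ℕ
maxLevel h []      = h
maxLevel h (U ∷ w) = h ⊔ maxLevel (suc h) w
maxLevel h (D ∷ w) = h ⊔ maxLevel (h ∸ 1) w

height : List Step → ℕ
height w = maxLevel 0 w

countG : ℕ → ℕ → ℕ
countG k m = length (filter (λ w → T? (isDyck w ∧ (height w ≤ᵇ k))) (words (2 * m)))

PS : Set
PS = ℕ → ℤ

_⊕_ : PS → PS → PS
(f ⊕ g) m = f m ℤ.+ g m

_⊖_ : PS → PS → PS
(f ⊖ g) m = f m ℤ.- g m

convSum : PS → PS → ℕ → ℕ → ℤ
convSum f g m zero    = + 0
convSum f g m (suc i) = convSum f g m i ℤ.+ (f i ℤ.* g (m ∸ i))

_⊛_ : PS → PS → PS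
(f ⊛ g) m = convSum f g m (suc m)

const : ℤ → PS
const a zero    = a
const a (suc m) = + 0

_·_ : ℤ → PS → PS
(a · f) m = a ℤ.* f m

sumPS : ℕ → (ℕ → PS) → PS
sumPS zero    F m = + 0
sumPS (suc N) F m = sumPS N F m ℤ.+ F N m

G : ℕ → PS
G k m = + countG k m

-- G_{n-1}, with G_{-1} = 0
Gpred : ℕ → PS
Gpred zero    m = + 0
Gpred (suc n) m = G n m

c : PS
c n = + (((2 * n) C n) / suc n)

Cser : PS
Cser = c ⊖ const (+ 1)

summand : ℕ → PS
summand n = (G n ⊖ Gpred n) ⊛ G (suc n)

-- Splitting a Dyck path at its first return to level 0 gives G_{k+1} = 1/(1 - x G_k).
-- For three consecutive such series, G_{k+2} (G_{k+1} - G_k) = G_{k+2} - G_k: the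
-- difference d of the two sides satisfies d = x G_{k+1} d, whose only solution is 0.
-- So the partial sums telescope to G_K + G_{K+1} - 1.  A path of semilength m <= K
-- never exceeds height K, so by the reflection principle the coefficient of x^m in
-- G_K is the Catalan number, and the partial sums agree with 2c - 1 = 1 + 2C there.

module Submission where

open import Defs
open import Data.Nat using (ℕ; _≤_)
open import Data.Integer using (+_)
open import Data.Product using (∃-syntax)
open import Relation.Binary.PropositionalEquality using (_≡_)

module StripWalks where

  open import Data.Nat
  open import Data.Nat.Properties
  open import Data.Nat.Combinatorics using (_C_; nCk+nC[k+1]≡[n+1]C[k+1]; nCk≡nC[n∸k]; k>n⇒nCk≡0; nC1≡n)
  open import Data.Nat.DivMod using (_/_; m*n/n≡m)
  open import Data.Nat.Tactic.RingSolver using (solve-∀)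
  open import Data.Parity.Base using (_⁻¹)
  open import Data.Parity.Properties using (suc-homo-⁻¹)
  open import Data.Bool using (Bool; true; false; _∧_; T)
  open import Data.Bool.Properties using (T?; T-∧)
  open import Data.List using (List; []; _∷_; filter; length; concatMap)
  open import Data.List.Properties using (filter-≐; filter-none)
  open import Data.List.Relation.Unary.All using (universal)
  open import Data.Product using (_,_; proj₂)
  open import Function using (_∘_; Equivalence)
  open import Relation.Nullary using (¬_)
  open import Relation.Nullary.Reflects using (det; fromEquivalence)
  open import Relation.Binary.PropositionalEquality

  countWords : ℕ → (List Step → Bool) → ℕ
  countWords n p = length (filter (T? ∘ p) (words n))

  length-filter-concatMap-steps : ∀ p ws →
    length (filter (T? ∘ p) (concatMap (λ w → (U ∷ w) ∷ (D ∷ w) ∷ []) ws))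
      ≡ length (filter (T? ∘ p ∘ (U ∷_)) ws) + length (filter (T? ∘ p ∘ (D ∷_)) ws)
  length-filter-concatMap-steps p [] = refl
  length-filter-concatMap-steps p (w ∷ ws) with p (U ∷ w)
  ... | true  with p (D ∷ w)
  ...   | true  = cong suc (trans (cong suc (length-filter-concatMap-steps p ws)) (sym (+-suc _ _)))
  ...   | false = cong suc (length-filter-concatMap-steps p ws)
  length-filter-concatMap-steps p (w ∷ ws)
      | false with p (D ∷ w)
  ...   | true  = trans (cong suc (length-filter-concatMap-steps p ws)) (sym (+-suc _ _))
  ...   | false = length-filter-concatMap-steps p ws

  countWords-suc : ∀ n p →
    countWords (suc n) p ≡ countWords n (p ∘ (U ∷_)) + countWords n (p ∘ (D ∷_))
  countWords-suc n p = length-filter-concatMap-steps p (words n)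

  countWords-cong : ∀ n {p q} → p ≗ q → countWords n p ≡ countWords n q
  countWords-cong n {p} {q} p≗q =
    cong length (filter-≐ (T? ∘ p) (T? ∘ q)
      ((λ {w} → subst T (p≗q w)) , (λ {w} → subst T (sym (p≗q w)))) (words n))

  countWords-none : ∀ n {p} → (∀ w → ¬ T (p w)) → countWords n p ≡ 0
  countWords-none n {p} none = cong length (filter-none (T? ∘ p) (universal none (words n)))

  fits : ℕ → ℕ → List Step → Bool
  fits h r w = staysEnds0 h w ∧ (maxLevel h w ≤ᵇ h + r)

  maxLevel-≥ : ∀ h w → h ≤ maxLevel h w
  maxLevel-≥ h []      = ≤-refl
  maxLevel-≥ h (U ∷ w) = m≤m⊔n h _
  maxLevel-≥ h (D ∷ w) = m≤m⊔n h _

  ⊔-≤ᵇ : ∀ {a m k} → a ≤ k → (a ⊔ m ≤ᵇ k) ≡ (m ≤ᵇ k)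
  ⊔-≤ᵇ {a} {m} {k} a≤k = det
    (fromEquivalence (λ t → ≤-trans (m≤n⊔m a m) (≤ᵇ⇒≤ _ _ t)) (λ m≤k → ≤⇒≤ᵇ (⊔-lub a≤k m≤k)))
    (≤ᵇ-reflects-≤ m k)

  fits-U : ∀ h r w → fits h (suc r) (U ∷ w) ≡ fits (suc h) r w
  fits-U h r w = cong (staysEnds0 (suc h) w ∧_)
    (trans (⊔-≤ᵇ {m = maxLevel (suc h) w} (m≤m+n h (suc r))) (cong (maxLevel (suc h) w ≤ᵇ_) (+-suc h r)))

  fits-D : ∀ h r w → fits (suc h) r (D ∷ w) ≡ fits h (suc r) w
  fits-D h r w = cong (staysEnds0 h w ∧_)
    (trans (⊔-≤ᵇ {m = maxLevel h w} (m≤m+n (suc h) r)) (cong (maxLevel h w ≤ᵇ_) (sym (+-suc h r))))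

  fits-U-ceiling : ∀ h w → ¬ T (fits h zero (U ∷ w))
  fits-U-ceiling h w t = n≮n h (begin-strict
    h                      <⟨ maxLevel-≥ (suc h) w ⟩
    maxLevel (suc h) w     ≤⟨ m≤n⊔m h _ ⟩
    h ⊔ maxLevel (suc h) w ≤⟨ ≤ᵇ⇒≤ _ _ (proj₂ (Equivalence.to T-∧ t)) ⟩
    h + 0                  ≡⟨ +-identityʳ h ⟩
    h                      ∎)
    where open ≤-Reasoning

  -- Walks of length n from level h to level 0 inside the strip [0, h + r]. Measuring the
  -- ceiling by the room r left above the current level makes the recursion structural.
  stripWalks : ℕ → ℕ → ℕ → ℕ
  stripWalks zero    r       zero    = 1
  stripWalks (suc h) r       zero    = 0
  stripWalks zero    zero    (suc n) = 0
  stripWalks zero    (suc r) (suc n) = stripWalks 1 r n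
  stripWalks (suc h) zero    (suc n) = stripWalks h 1 n
  stripWalks (suc h) (suc r) (suc n) = stripWalks (suc (suc h)) r n + stripWalks h (suc (suc r)) n

  countWords-fits : ∀ n h r → countWords n (fits h r) ≡ stripWalks h r n
  countWords-fits zero    zero    r = refl
  countWords-fits zero    (suc h) r = refl
  countWords-fits (suc n) h r = trans (countWords-suc n (fits h r)) (steps h r)
    where
    up : ∀ h r → countWords n (fits h (suc r) ∘ (U ∷_)) ≡ stripWalks (suc h) r n
    up h r = trans (countWords-cong n (fits-U h r)) (countWords-fits n (suc h) r)

    down : ∀ h r → countWords n (fits (suc h) r ∘ (D ∷_)) ≡ stripWalks h (suc r) n
    down h r = trans (countWords-cong n (fits-D h r)) (countWords-fits n h (suc r))

    steps : ∀ h r → countWords n (fits h r ∘ (U ∷_)) + countWords n (fits h r ∘ (D ∷_))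
                    ≡ stripWalks h r (suc n)
    steps zero    zero    = cong₂ _+_ (countWords-none n (fits-U-ceiling 0)) (countWords-none n λ _ ())
    steps zero    (suc r) = trans (cong₂ _+_ (up 0 r) (countWords-none n λ _ ())) (+-identityʳ _)
    steps (suc h) zero    = cong₂ _+_ (countWords-none n (fits-U-ceiling (suc h))) (down h 0)
    steps (suc h) (suc r) = cong₂ _+_ (up (suc h) r) (down h (suc r))

  countG≡stripWalks : ∀ k m → countG k m ≡ stripWalks 0 k (2 * m)
  countG≡stripWalks k m = countWords-fits (2 * m) 0 k

  parity-swap : ∀ m n → parity m ≡ parity (suc n) → parity (suc m) ≡ parity n
  parity-swap m n e = trans (sym (suc-homo-⁻¹ (suc m))) (trans (cong _⁻¹ e) (suc-homo-⁻¹ n))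

  stripWalks-parity : ∀ h r n → parity (suc n) ≡ parity h → stripWalks h r n ≡ 0
  stripWalks-parity zero    r       zero    ()
  stripWalks-parity (suc h) r       zero    _ = refl
  stripWalks-parity zero    zero    (suc n) _ = refl
  stripWalks-parity zero    (suc r) (suc n) e = stripWalks-parity 1 r n (parity-swap n 1 e)
  stripWalks-parity (suc h) zero    (suc n) e = stripWalks-parity h 1 n (parity-swap n h e)
  stripWalks-parity (suc h) (suc r) (suc n) e = cong₂ _+_
    (stripWalks-parity (suc (suc h)) r n (parity-swap n h e))
    (stripWalks-parity h (suc (suc r)) n (parity-swap n h e))

  stripWalks-below : ∀ h r n → n < h → stripWalks h r n ≡ 0
  stripWalks-below (suc h) r       zero    _         = refl
  stripWalks-below (suc h) zero    (suc n) (s≤s n<h) = stripWalks-below h 1 n n<h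
  stripWalks-below (suc h) (suc r) (suc n) (s≤s n<h) = cong₂ _+_
    (stripWalks-below (suc (suc h)) r n (m<n⇒m<1+n (m<n⇒m<1+n n<h)))
    (stripWalks-below h (suc (suc r)) n n<h)

  stripWalks-diagonal : ∀ h r → stripWalks h r h ≡ 1
  stripWalks-diagonal zero    r       = refl
  stripWalks-diagonal (suc h) zero    = stripWalks-diagonal h 1
  stripWalks-diagonal (suc h) (suc r) = cong₂ _+_
    (stripWalks-below (suc (suc h)) r h (m<n⇒m<1+n (n<1+n h)))
    (stripWalks-diagonal h (suc (suc r)))

  C-complement : ∀ {n} k l → n ≡ k + l → n C k ≡ n C l
  C-complement k l refl = trans (nCk≡nC[n∸k] (m≤m+n k l)) (cong ((k + l) C_) (m+n∸m≡n k l))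

  C-absorption : ∀ n k → suc k * (suc n C suc k) ≡ suc n * (n C k)
  C-absorption zero    zero    = refl
  C-absorption zero    (suc k) =
    trans (cong (suc (suc k) *_) (k>n⇒nCk≡0 {1} (s≤s (s≤s (z≤n {k}))))) (*-zeroʳ (suc (suc k)))
  C-absorption (suc n) zero    = trans (+-identityʳ _) (trans (nC1≡n (suc (suc n))) (sym (*-identityʳ _)))
  C-absorption (suc n) (suc k) = begin
    suc (suc k) * (suc (suc n) C suc (suc k))
      ≡⟨ cong (suc (suc k) *_) (sym (nCk+nC[k+1]≡[n+1]C[k+1] (suc n) (suc k))) ⟩
    suc (suc k) * (a + b)
      ≡⟨ rearrange k a b ⟩
    a + suc k * a + suc (suc k) * b
      ≡⟨ cong₂ (λ x y → a + x + y) (C-absorption n k) (C-absorption n (suc k)) ⟩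
    a + suc n * (n C k) + suc n * (n C suc k)
      ≡⟨ cong (λ x → x + suc n * (n C k) + suc n * (n C suc k)) (sym (nCk+nC[k+1]≡[n+1]C[k+1] n k)) ⟩
    n C k + n C suc k + suc n * (n C k) + suc n * (n C suc k)
      ≡⟨ collect n (n C k) (n C suc k) ⟩
    suc (suc n) * (n C k + n C suc k)
      ≡⟨ cong (suc (suc n) *_) (nCk+nC[k+1]≡[n+1]C[k+1] n k) ⟩
    suc (suc n) * a
      ∎
    where
    open ≡-Reasoning
    a = suc n C suc k
    b = suc n C suc (suc k)
    rearrange : ∀ k a b → suc (suc k) * (a + b) ≡ a + suc k * a + suc (suc k) * b
    rearrange = solve-∀
    collect : ∀ n x y → x + y + suc n * x + suc n * y ≡ suc (suc n) * (x + y)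
    collect = solve-∀

  C-ratio : ∀ v → suc (suc v) * (suc (v + suc v) C v) ≡ suc v * (suc (v + suc v) C suc v)
  C-ratio v = begin
    suc (suc v) * (suc n C v)
      ≡⟨ cong (suc (suc v) *_) (C-complement v (suc (suc v)) (sym (+-suc v (suc v)))) ⟩
    suc (suc v) * (suc n C suc (suc v))
      ≡⟨ C-absorption n (suc v) ⟩
    suc n * (n C suc v)
      ≡⟨ cong (suc n *_) (sym (C-complement v (suc v) refl)) ⟩
    suc n * (n C v)
      ≡⟨ sym (C-absorption n v) ⟩
    suc v * (suc n C suc v)
      ∎
    where
    open ≡-Reasoning
    n = v + suc v

  ballot-step : ∀ n k {a b} → a + n C k ≡ n C suc k → b + n C suc k ≡ n C suc (suc k) →
                (a + b) + suc n C suc k ≡ suc n C suc (suc k)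
  ballot-step n k {a} {b} ea eb = begin
    (a + b) + suc n C suc k           ≡⟨ cong (_+_ (a + b)) (sym (nCk+nC[k+1]≡[n+1]C[k+1] n k)) ⟩
    (a + b) + (n C k + n C suc k)     ≡⟨ interchange a b (n C k) (n C suc k) ⟩
    (a + n C k) + (b + n C suc k)     ≡⟨ cong₂ _+_ ea eb ⟩
    n C suc k + n C suc (suc k)       ≡⟨ nCk+nC[k+1]≡[n+1]C[k+1] n (suc k) ⟩
    suc n C suc (suc k)               ∎
    where
    open ≡-Reasoning
    interchange : ∀ a b c d → (a + b) + (c + d) ≡ (a + c) + (b + d)
    interchange = solve-∀

  -- Reaching level h + r + 1 takes at least h + 2r + 2 steps, so for v < r the ceiling is
  -- irrelevant and the reflection principle gives the ballot number n C (v + 1) - n C v.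
  ballot : ∀ h {r v} n → v < r → n ≡ h + 2 * suc v → stripWalks h r n + n C v ≡ n C suc v
  ballot zero    zero _ ()
  ballot (suc h) zero _ ()
  ballot zero {suc zero}    {zero} (suc n) _ refl = refl
  ballot zero {suc (suc r)} {zero} (suc n) _ refl = refl
  -- From level 0 only the up-step is possible; the missing down-branch is accounted for by
  -- the symmetry of the two middle binomials of the odd row n.
  ballot zero {suc r} {suc w} (suc n) (s≤s w<r) e =
    trans (cong (_+ suc n C suc w) (sym (+-identityʳ _)))
          (ballot-step n w (ballot 1 n w<r n≡) (C-complement (suc w) (suc (suc w)) (trans n≡ (odd w))))
    where
    n≡ : n ≡ 1 + 2 * suc w
    n≡ = suc-injective (trans e (*-suc 2 (suc w)))
    odd : ∀ w → 1 + 2 * suc w ≡ suc w + suc (suc w)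
    odd = solve-∀
  ballot (suc h) {suc r} {zero} (suc n) _ e = begin
    (stripWalks (suc (suc h)) r n + d) + 1   ≡⟨ cong (λ u → (u + d) + 1) straight-descent ⟩
    suc (d + 1)                              ≡⟨ cong suc (trans (ballot h n (s≤s z≤n) n≡) (nC1≡n n)) ⟩
    suc n                                    ≡⟨ sym (nC1≡n (suc n)) ⟩
    suc n C 1                                ∎
    where
    open ≡-Reasoning
    d = stripWalks h (suc (suc r)) n
    n≡ : n ≡ h + 2
    n≡ = suc-injective e
    straight-descent : stripWalks (suc (suc h)) r n ≡ 1
    straight-descent = subst (λ n → stripWalks (suc (suc h)) r n ≡ 1)
      (sym (trans n≡ (+-comm h 2))) (stripWalks-diagonal (suc (suc h)) r)
  ballot (suc h) {suc r} {suc w} (suc n) (s≤s w<r) e =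
    ballot-step n w (ballot (suc (suc h)) n w<r (trans n≡ (shift h w))) (ballot h n (s≤s (m≤n⇒m≤1+n w<r)) n≡)
    where
    n≡ : n ≡ h + 2 * suc (suc w)
    n≡ = suc-injective e
    shift : ∀ h w → h + 2 * suc (suc w) ≡ suc (suc h) + 2 * suc w
    shift = solve-∀

  double-suc : ∀ v → 2 * suc v ≡ suc (v + suc v)
  double-suc = solve-∀

  stripWalks-catalan : ∀ {r} m → m ≤ r → stripWalks 0 r (2 * m) * suc m ≡ (2 * m) C m
  stripWalks-catalan zero _ = refl
  stripWalks-catalan {r} (suc v) v<r =
    subst (λ n → stripWalks 0 r n * suc (suc v) ≡ n C suc v) (sym (double-suc v)) (
    +-cancelʳ-≡ (suc v * X) (W * suc (suc v)) X (begin
      W * suc (suc v) + suc v * X        ≡⟨ cong (_+_ (W * suc (suc v))) (sym (C-ratio v)) ⟩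
      W * suc (suc v) + suc (suc v) * Y  ≡⟨ factor W Y v ⟩
      (W + Y) * suc (suc v)              ≡⟨ cong (_* suc (suc v)) (ballot 0 N v<r (sym (double-suc v))) ⟩
      X * suc (suc v)                    ≡⟨ expand X v ⟩
      X + suc v * X                      ∎))
    where
    open ≡-Reasoning
    N = suc (v + suc v)
    W = stripWalks 0 r N
    X = N C suc v
    Y = N C v
    factor : ∀ w y v → w * suc (suc v) + suc (suc v) * y ≡ (w + y) * suc (suc v)
    factor = solve-∀
    expand : ∀ x v → x * suc (suc v) ≡ x + suc v * x
    expand = solve-∀

  stripWalks≡catalan : ∀ {r} m → m ≤ r → stripWalks 0 r (2 * m) ≡ ((2 * m) C m) / suc m
  stripWalks≡catalan m m≤r =
    trans (sym (m*n/n≡m (stripWalks 0 _ (2 * m)) (suc m))) (cong (_/ suc m) (stripWalks-catalan m m≤r))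

module CauchyProduct where

  open import Data.Nat as ℕ using (ℕ; zero; suc; _≤_; z≤n; s≤s; parity)
  open import Data.Nat.Properties using (≤-refl; ≤-trans; m≤n⇒m≤1+n; *-suc)
  open import Data.Parity.Base using (1ℙ)
  open import Data.Integer using (+_; _+_; _*_; _-_)
  open import Data.Integer.Properties using (+-identityˡ; +-identityʳ; +-assoc; *-identityˡ; *-zeroʳ; *-assoc; *-comm; *-distribˡ-+; *-distribʳ-+)
  open import Data.Integer.Tactic.RingSolver using (solve-∀)
  open import Function using (_∘_)
  open import Relation.Binary.PropositionalEquality

  conv : PS → PS → PS
  conv f g zero    = f 0 * g 0
  conv f g (suc n) = f 0 * g (suc n) + conv (f ∘ suc) g n

  convSum-suc : ∀ f g m i → convSum f g (suc m) (suc i) ≡ f 0 * g (suc m) + convSum (f ∘ suc) g m i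
  convSum-suc f g m zero    = trans (+-identityˡ (f 0 * g (suc m))) (sym (+-identityʳ (f 0 * g (suc m))))
  convSum-suc f g m (suc i) = trans (cong (_+ f (suc i) * g (m ℕ.∸ i)) (convSum-suc f g m i))
                                    (+-assoc (f 0 * g (suc m)) _ _)

  ⊛≗conv : ∀ f g → f ⊛ g ≗ conv f g
  ⊛≗conv f g zero    = +-identityˡ _
  ⊛≗conv f g (suc m) = trans (convSum-suc f g m (suc m)) (cong (_+_ (f 0 * g (suc m))) (⊛≗conv (f ∘ suc) g m))

  conv-congˡ : ∀ {f f′} g → f ≗ f′ → conv f g ≗ conv f′ g
  conv-congˡ g f≗f′ zero    = cong (_* g 0) (f≗f′ 0)
  conv-congˡ g f≗f′ (suc n) = cong₂ _+_ (cong (_* g (suc n)) (f≗f′ 0)) (conv-congˡ g (f≗f′ ∘ suc) n)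

  conv-congʳ : ∀ f {g g′} → g ≗ g′ → conv f g ≗ conv f g′
  conv-congʳ f g≗g′ zero    = cong (f 0 *_) (g≗g′ 0)
  conv-congʳ f g≗g′ (suc n) = cong₂ _+_ (cong (f 0 *_) (g≗g′ (suc n))) (conv-congʳ (f ∘ suc) g≗g′ n)

  conv-zeroˡ : ∀ g → conv (λ _ → + 0) g ≗ (λ _ → + 0)
  conv-zeroˡ g zero    = refl
  conv-zeroˡ g (suc n) = trans (+-identityˡ _) (conv-zeroˡ g n)

  conv-identityˡ : ∀ g → conv (const (+ 1)) g ≗ g
  conv-identityˡ g zero    = *-identityˡ (g 0)
  conv-identityˡ g (suc n) =
    trans (cong₂ _+_ (*-identityˡ (g (suc n))) (conv-zeroˡ g n)) (+-identityʳ (g (suc n)))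

  conv-vanishʳ : ∀ f {g} n → (∀ j → j ≤ n → g j ≡ + 0) → conv f g n ≡ + 0
  conv-vanishʳ f zero    g≡0 = trans (cong (f 0 *_) (g≡0 0 z≤n)) (*-zeroʳ (f 0))
  conv-vanishʳ f (suc n) g≡0 = cong₂ _+_
    (trans (cong (f 0 *_) (g≡0 (suc n) ≤-refl)) (*-zeroʳ (f 0)))
    (conv-vanishʳ (f ∘ suc) n (λ j j≤n → g≡0 j (m≤n⇒m≤1+n j≤n)))

  conv-distribˡ : ∀ f g h → conv (f ⊕ g) h ≗ conv f h ⊕ conv g h
  conv-distribˡ f g h zero    = *-distribʳ-+ (h 0) (f 0) (g 0)
  conv-distribˡ f g h (suc n) =
    trans (cong (_+_ ((f 0 + g 0) * h (suc n))) (conv-distribˡ (f ∘ suc) (g ∘ suc) h n))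
          (rearrange (f 0) (g 0) (h (suc n)) _ _)
    where
    rearrange : ∀ a b c x y → (a + b) * c + (x + y) ≡ (a * c + x) + (b * c + y)
    rearrange = solve-∀

  conv-distribʳ : ∀ f g h → conv f (g ⊕ h) ≗ conv f g ⊕ conv f h
  conv-distribʳ f g h zero    = *-distribˡ-+ (f 0) (g 0) (h 0)
  conv-distribʳ f g h (suc n) =
    trans (cong (_+_ (f 0 * (g (suc n) + h (suc n)))) (conv-distribʳ (f ∘ suc) g h n))
          (rearrange (f 0) (g (suc n)) (h (suc n)) _ _)
    where
    rearrange : ∀ a b c x y → a * (b + c) + (x + y) ≡ (a * b + x) + (a * c + y)
    rearrange = solve-∀

  conv-distribʳ-⊖ : ∀ f g h → conv f (g ⊖ h) ≗ conv f g ⊖ conv f h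
  conv-distribʳ-⊖ f g h zero    = rearrange (f 0) (g 0) (h 0)
    where
    rearrange : ∀ a b c → a * (b - c) ≡ a * b - a * c
    rearrange = solve-∀
  conv-distribʳ-⊖ f g h (suc n) =
    trans (cong (_+_ (f 0 * (g (suc n) - h (suc n)))) (conv-distribʳ-⊖ (f ∘ suc) g h n))
          (rearrange (f 0) (g (suc n)) (h (suc n)) _ _)
    where
    rearrange : ∀ a b c x y → a * (b - c) + (x - y) ≡ (a * b + x) - (a * c + y)
    rearrange = solve-∀

  conv-scaleˡ : ∀ a f h n → conv (a · f) h n ≡ a * conv f h n
  conv-scaleˡ a f h zero    = *-assoc a (f 0) (h 0)
  conv-scaleˡ a f h (suc n) =
    trans (cong (_+_ (a * f 0 * h (suc n))) (conv-scaleˡ a (f ∘ suc) h n))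
          (rearrange a (f 0) (h (suc n)) _)
    where
    rearrange : ∀ a b c x → a * b * c + a * x ≡ a * (b * c + x)
    rearrange = solve-∀

  conv-assoc : ∀ f g h → conv (conv f g) h ≗ conv f (conv g h)
  conv-assoc f g h zero    = *-assoc (f 0) (g 0) (h 0)
  conv-assoc f g h (suc n) = begin
    f 0 * g 0 * h (suc n) + conv (conv f g ∘ suc) h n
      ≡⟨ cong (_+_ (f 0 * g 0 * h (suc n))) (conv-distribˡ (f 0 · (g ∘ suc)) (conv (f ∘ suc) g) h n) ⟩
    f 0 * g 0 * h (suc n) + (conv (f 0 · (g ∘ suc)) h n + conv (conv (f ∘ suc) g) h n)
      ≡⟨ cong₂ (λ x y → f 0 * g 0 * h (suc n) + (x + y))
               (conv-scaleˡ (f 0) (g ∘ suc) h n) (conv-assoc (f ∘ suc) g h n) ⟩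
    f 0 * g 0 * h (suc n) + (f 0 * conv (g ∘ suc) h n + conv (f ∘ suc) (conv g h) n)
      ≡⟨ rearrange (f 0) (g 0) (h (suc n)) _ _ ⟩
    f 0 * (g 0 * h (suc n) + conv (g ∘ suc) h n) + conv (f ∘ suc) (conv g h) n
      ∎
    where
    open ≡-Reasoning
    rearrange : ∀ a b c x y → a * b * c + (a * x + y) ≡ a * (b * c + x) + y
    rearrange = solve-∀

  conv-suc : ∀ f g n → conv f g (suc n) ≡ conv f (g ∘ suc) n + f (suc n) * g 0
  conv-suc f g zero    = refl
  conv-suc f g (suc n) = trans (cong (_+_ (f 0 * g (suc (suc n)))) (conv-suc (f ∘ suc) g n))
                               (sym (+-assoc (f 0 * g (suc (suc n))) _ _))

  conv-comm : ∀ f g → conv f g ≗ conv g f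
  conv-comm f g zero    = *-comm (f 0) (g 0)
  conv-comm f g (suc n) = begin
    f 0 * g (suc n) + conv (f ∘ suc) g n   ≡⟨ cong (_+_ (f 0 * g (suc n))) (conv-comm (f ∘ suc) g n) ⟩
    f 0 * g (suc n) + conv g (f ∘ suc) n   ≡⟨ swap (f 0) (g (suc n)) _ ⟩
    conv g (f ∘ suc) n + g (suc n) * f 0   ≡⟨ sym (conv-suc g f n) ⟩
    conv g f (suc n)                       ∎
    where
    open ≡-Reasoning
    swap : ∀ a b x → a * b + x ≡ x + b * a
    swap = solve-∀

  conv-even : ∀ m {f} g → (∀ n → parity n ≡ 1ℙ → f n ≡ + 0) →
              conv f g (2 ℕ.* m) ≡ conv (f ∘ (2 ℕ.*_)) (g ∘ (2 ℕ.*_)) m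
  conv-even zero    g odd = refl
  conv-even (suc m) {f} g odd = begin
    conv f g (2 ℕ.* suc m)
      ≡⟨ cong (conv f g) (*-suc 2 m) ⟩
    f 0 * g (2 ℕ.+ 2 ℕ.* m) + (f 1 * g (suc (2 ℕ.* m)) + conv (f ∘ suc ∘ suc) g (2 ℕ.* m))
      ≡⟨ cong (λ x → f 0 * g (2 ℕ.+ 2 ℕ.* m) + (x * g (suc (2 ℕ.* m)) + conv (f ∘ suc ∘ suc) g (2 ℕ.* m)))
              (odd 1 refl) ⟩
    f 0 * g (2 ℕ.+ 2 ℕ.* m) + (+ 0 + conv (f ∘ suc ∘ suc) g (2 ℕ.* m))
      ≡⟨ cong (_+_ (f 0 * g (2 ℕ.+ 2 ℕ.* m))) (trans (+-identityˡ _) (conv-even m g (odd ∘ suc ∘ suc))) ⟩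
    f 0 * g (2 ℕ.+ 2 ℕ.* m) + conv (λ i → f (2 ℕ.+ 2 ℕ.* i)) (g ∘ (2 ℕ.*_)) m
      ≡⟨ cong₂ (λ x y → f 0 * g x + y) (sym (*-suc 2 m)) (conv-congˡ (g ∘ (2 ℕ.*_)) (λ i → cong f (sym (*-suc 2 i))) m) ⟩
    conv (f ∘ (2 ℕ.*_)) (g ∘ (2 ℕ.*_)) (suc m)
      ∎
    where open ≡-Reasoning

  shift-conv-fixedPoint≡0 : ∀ b {d} → d 0 ≡ + 0 → (∀ m → d (suc m) ≡ conv b d m) → d ≗ (λ _ → + 0)
  shift-conv-fixedPoint≡0 b {d} d₀ d-suc n = upTo n n ≤-refl
    where
    upTo : ∀ n j → j ≤ n → d j ≡ + 0
    upTo n       zero    _         = d₀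
    upTo (suc n) (suc j) (s≤s j≤n) =
      trans (d-suc j) (conv-vanishʳ b j (λ i i≤j → upTo n i (≤-trans i≤j j≤n)))

  -- A₁ = 1 / (1 - x A₀)
  record NextConvergent (A₀ A₁ : PS) : Set where
    field
      constant   : A₁ 0 ≡ + 1
      recurrence : ∀ m → A₁ (suc m) ≡ conv A₀ A₁ m

  open NextConvergent

  -- d = A₂ (A₁ - A₀) - A₂ + A₀ satisfies d = x A₁ d, because x A₁ A₂ = A₂ - 1 and x A₀ A₁ = A₁ - 1.
  next-convergent-difference : ∀ {A₀ A₁ A₂} → NextConvergent A₀ A₁ → NextConvergent A₁ A₂ →
                               conv (A₁ ⊖ A₀) A₂ ≗ A₂ ⊖ A₀
  next-convergent-difference {A₀} {A₁} {A₂} c₁ c₂ m = begin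
    conv (A₁ ⊖ A₀) A₂ m                       ≡⟨ conv-comm (A₁ ⊖ A₀) A₂ m ⟩
    conv A₂ y m                               ≡⟨ split (conv A₂ y m) (A₂ m) (A₀ m) ⟩
    d m + (A₂ m - A₀ m)                       ≡⟨ cong (_+ (A₂ m - A₀ m)) (shift-conv-fixedPoint≡0 A₁ d-zero d-suc m) ⟩
    + 0 + (A₂ m - A₀ m)                       ≡⟨ +-identityˡ (A₂ m - A₀ m) ⟩
    A₂ m - A₀ m                               ∎
    where
    open ≡-Reasoning
    y = A₁ ⊖ A₀
    d = (conv A₂ y ⊖ A₂) ⊕ A₀

    split : ∀ x a b → x ≡ (x - a + b) + (a - b)
    split = solve-∀

    d-zero : d 0 ≡ + 0
    d-zero rewrite constant c₁ | constant c₂ = cancel (A₀ 0)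
      where
      cancel : ∀ a → + 1 * (+ 1 - a) - + 1 + a ≡ + 0
      cancel = solve-∀

    d-suc : ∀ m → d (suc m) ≡ conv A₁ d m
    d-suc m = begin
      A₂ 0 * (A₁ (suc m) - A₀ (suc m)) + conv (A₂ ∘ suc) y m - A₂ (suc m) + A₀ (suc m)
        ≡⟨ cong₂ (λ a b → a * (b - A₀ (suc m)) + conv (A₂ ∘ suc) y m - A₂ (suc m) + A₀ (suc m))
                 (constant c₂) (recurrence c₁ m) ⟩
      + 1 * (conv A₀ A₁ m - A₀ (suc m)) + conv (A₂ ∘ suc) y m - A₂ (suc m) + A₀ (suc m)
        ≡⟨ cong₂ (λ u v → + 1 * (conv A₀ A₁ m - A₀ (suc m)) + u - v + A₀ (suc m))
                 (trans (conv-congˡ y (recurrence c₂) m) (conv-assoc A₁ A₂ y m)) (recurrence c₂ m) ⟩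
      + 1 * (conv A₀ A₁ m - A₀ (suc m)) + conv A₁ (conv A₂ y) m - conv A₁ A₂ m + A₀ (suc m)
        ≡⟨ collect (conv A₀ A₁ m) (A₀ (suc m)) (conv A₁ (conv A₂ y) m) (conv A₁ A₂ m) ⟩
      conv A₁ (conv A₂ y) m - conv A₁ A₂ m + conv A₀ A₁ m
        ≡⟨ cong (_+_ (conv A₁ (conv A₂ y) m - conv A₁ A₂ m)) (conv-comm A₀ A₁ m) ⟩
      conv A₁ (conv A₂ y) m - conv A₁ A₂ m + conv A₁ A₀ m
        ≡⟨ cong (_+ conv A₁ A₀ m) (sym (conv-distribʳ-⊖ A₁ (conv A₂ y) A₂ m)) ⟩
      conv A₁ (conv A₂ y ⊖ A₂) m + conv A₁ A₀ m
        ≡⟨ sym (conv-distribʳ A₁ (conv A₂ y ⊖ A₂) A₀ m) ⟩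
      conv A₁ d m
        ∎
      where
      collect : ∀ p a q s → + 1 * (p - a) + q - s + a ≡ q - s + p
      collect = solve-∀

open StripWalks using (stripWalks; countG≡stripWalks; parity-swap; stripWalks-parity; stripWalks≡catalan)
open CauchyProduct

open import Data.Nat as ℕ using (zero; suc; s≤s)
open import Data.Nat.Properties using (+-suc; *-suc; m≤n⇒m≤1+n)
open import Data.Integer using (_+_; _*_; _-_)
open import Data.Integer.Properties using (+-identityˡ; +-identityʳ; *-identityˡ; +-comm; pos-+)
open import Data.Integer.Tactic.RingSolver using (solve-∀)
open import Data.Product using (_,_)
open import Function using (_∘_)
open import Relation.Binary.PropositionalEquality using (refl; sym; trans; cong; cong₂; _≗_; module ≡-Reasoning)
open ≡-Reasoning

walkSeries : ℕ → ℕ → PS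
walkSeries h r n = + stripWalks h r n

-- Split a walk from h + 1 at its first visit to 0: shifted down by one, the part
-- before it is a walk from h to 0 under the ceiling k, followed by a down-step and
-- a walk from 0 under the original ceiling k + 1.
first-passage : ∀ n h r {k} → h ℕ.+ r ≡ k →
  walkSeries (suc h) r (suc n) ≡ conv (walkSeries h r) (walkSeries 0 (suc k)) n
first-passage zero    zero    zero    _ = refl
first-passage zero    zero    (suc r) _ = refl
first-passage zero    (suc h) zero    _ = refl
first-passage zero    (suc h) (suc r) _ = refl
first-passage (suc n) zero    zero    refl =
  sym (trans (cong₂ _+_ (*-identityˡ (walkSeries 0 1 (suc n))) (conv-zeroˡ (walkSeries 0 1) n))
             (+-identityʳ (walkSeries 0 1 (suc n))))
first-passage (suc n) zero    (suc r) refl = begin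
  + (stripWalks 2 r (suc n) ℕ.+ stripWalks 0 (suc (suc r)) (suc n))
    ≡⟨ pos-+ (stripWalks 2 r (suc n)) _ ⟩
  walkSeries 2 r (suc n) + walkSeries 0 (suc (suc r)) (suc n)
    ≡⟨ cong (_+ walkSeries 0 (suc (suc r)) (suc n)) (first-passage n 1 r refl) ⟩
  conv (walkSeries 1 r) (walkSeries 0 (suc (suc r))) n + walkSeries 0 (suc (suc r)) (suc n)
    ≡⟨ +-comm (conv (walkSeries 1 r) (walkSeries 0 (suc (suc r))) n) _ ⟩
  walkSeries 0 (suc (suc r)) (suc n) + conv (walkSeries 1 r) (walkSeries 0 (suc (suc r))) n
    ≡⟨ cong (_+ conv (walkSeries 1 r) (walkSeries 0 (suc (suc r))) n) (sym (*-identityˡ (walkSeries 0 (suc (suc r)) (suc n)))) ⟩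
  conv (walkSeries 0 (suc r)) (walkSeries 0 (suc (suc r))) (suc n)
    ∎
first-passage (suc n) (suc h) zero    e =
  trans (first-passage n h 1 (trans (+-suc h 0) e)) (sym (+-identityˡ _))
first-passage (suc n) (suc h) (suc r) {k} e = begin
  + (stripWalks (suc (suc (suc h))) r (suc n) ℕ.+ stripWalks (suc h) (suc (suc r)) (suc n))
    ≡⟨ pos-+ (stripWalks (suc (suc (suc h))) r (suc n)) _ ⟩
  walkSeries (suc (suc (suc h))) r (suc n) + walkSeries (suc h) (suc (suc r)) (suc n)
    ≡⟨ cong₂ _+_ (first-passage n (suc (suc h)) r (trans (cong suc (sym (+-suc h r))) e))
                 (first-passage n h (suc (suc r)) (trans (+-suc h (suc r)) e)) ⟩
  conv (walkSeries (suc (suc h)) r) b n + conv (walkSeries h (suc (suc r))) b n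
    ≡⟨ sym (conv-distribˡ (walkSeries (suc (suc h)) r) (walkSeries h (suc (suc r))) b n) ⟩
  conv (walkSeries (suc (suc h)) r ⊕ walkSeries h (suc (suc r))) b n
    ≡⟨ conv-congˡ b (λ t → sym (pos-+ (stripWalks (suc (suc h)) r t) _)) n ⟩
  conv (walkSeries (suc h) (suc r) ∘ suc) b n
    ≡⟨ sym (+-identityˡ _) ⟩
  conv (walkSeries (suc h) (suc r)) b (suc n)
    ∎
  where
  b = walkSeries 0 (suc k)

G≡walkSeries : ∀ k m → G k m ≡ walkSeries 0 k (2 ℕ.* m)
G≡walkSeries k m = cong +_ (countG≡stripWalks k m)

G-zero : G 0 ≗ const (+ 1)
G-zero zero    = G≡walkSeries 0 0
G-zero (suc m) = G≡walkSeries 0 (suc m)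

G-next : ∀ k → NextConvergent (G k) (G (suc k))
G-next k = record { constant = G≡walkSeries (suc k) 0 ; recurrence = recurrence }
  where
  recurrence : ∀ m → G (suc k) (suc m) ≡ conv (G k) (G (suc k)) m
  recurrence m = begin
    G (suc k) (suc m)
      ≡⟨ G≡walkSeries (suc k) (suc m) ⟩
    walkSeries 0 (suc k) (2 ℕ.* suc m)
      ≡⟨ cong (walkSeries 0 (suc k)) (*-suc 2 m) ⟩
    walkSeries 1 k (suc (2 ℕ.* m))
      ≡⟨ first-passage (2 ℕ.* m) 0 k refl ⟩
    conv (walkSeries 0 k) (walkSeries 0 (suc k)) (2 ℕ.* m)
      ≡⟨ conv-even m (walkSeries 0 (suc k))
           (λ n odd → cong +_ (stripWalks-parity 0 k n (parity-swap n 0 odd))) ⟩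
    conv (walkSeries 0 k ∘ (2 ℕ.*_)) (walkSeries 0 (suc k) ∘ (2 ℕ.*_)) m
      ≡⟨ sym (trans (conv-congˡ (G (suc k)) (G≡walkSeries k) m)
                    (conv-congʳ (walkSeries 0 k ∘ (2 ℕ.*_)) (G≡walkSeries (suc k)) m)) ⟩
    conv (G k) (G (suc k)) m
      ∎

G-catalan : ∀ {k m} → m ≤ k → G k m ≡ c m
G-catalan {k} {m} m≤k = cong +_ (trans (countG≡stripWalks k m) (stripWalks≡catalan m m≤k))

sumPS-summand : ∀ K → sumPS (suc K) summand ≗ (G K ⊕ G (suc K)) ⊖ const (+ 1)
sumPS-summand zero m = begin
  + 0 + summand 0 m                      ≡⟨ +-identityˡ (summand 0 m) ⟩
  summand 0 m                            ≡⟨ ⊛≗conv (G 0 ⊖ Gpred 0) (G 1) m ⟩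
  conv (G 0 ⊖ Gpred 0) (G 1) m           ≡⟨ conv-congˡ (G 1) (λ j → trans (+-identityʳ (G 0 j)) (G-zero j)) m ⟩
  conv (const (+ 1)) (G 1) m             ≡⟨ conv-identityˡ (G 1) m ⟩
  G 1 m                                  ≡⟨ add-cancel (const (+ 1) m) (G 1 m) ⟩
  const (+ 1) m + G 1 m - const (+ 1) m  ≡⟨ cong (λ u → u + G 1 m - const (+ 1) m) (sym (G-zero m)) ⟩
  G 0 m + G 1 m - const (+ 1) m          ∎
  where
  add-cancel : ∀ a y → y ≡ a + y - a
  add-cancel = solve-∀
sumPS-summand (suc K) m = begin
  sumPS (suc K) summand m + summand (suc K) m
    ≡⟨ cong₂ _+_ (sumPS-summand K m)
                 (trans (⊛≗conv (G (suc K) ⊖ G K) (G (suc (suc K))) m)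
                        (next-convergent-difference (G-next K) (G-next (suc K)) m)) ⟩
  (G K m + G (suc K) m - const (+ 1) m) + (G (suc (suc K)) m - G K m)
    ≡⟨ telescope (G K m) (G (suc K) m) (G (suc (suc K)) m) (const (+ 1) m) ⟩
  G (suc K) m + G (suc (suc K)) m - const (+ 1) m
    ∎
  where
  telescope : ∀ a b c e → (a + b - e) + (c - a) ≡ b + c - e
  telescope = solve-∀

theorem3p2 : (m : ℕ) → ∃[ N₀ ] ((N : ℕ) → N₀ ≤ N →
               sumPS N summand m ≡ (const (+ 1) ⊕ ((+ 2) · Cser)) m)
theorem3p2 m = suc m , coefficient-stable
  where
  regroup : ∀ x e → x + x - e ≡ e + + 2 * (x - e)
  regroup = solve-∀

  coefficient-stable : ∀ N → suc m ≤ N → sumPS N summand m ≡ (const (+ 1) ⊕ ((+ 2) · Cser)) m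
  coefficient-stable (suc K) (s≤s m≤K) = begin
    sumPS (suc K) summand m              ≡⟨ sumPS-summand K m ⟩
    G K m + G (suc K) m - const (+ 1) m  ≡⟨ cong₂ (λ a b → a + b - const (+ 1) m)
                                                  (G-catalan m≤K) (G-catalan (m≤n⇒m≤1+n m≤K)) ⟩
    c m + c m - const (+ 1) m            ≡⟨ regroup (c m) (const (+ 1) m) ⟩
    const (+ 1) m + + 2 * (c m - const (+ 1) m) ∎
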